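{- For every integer $n \geq 4$, let $W_n$ be the wheel graph on $n$ vertices, obtained from the cycle $C_{n-1}$ by adding one vertex adjacent to all vertices of the cycle. Then $$\chi^=_1(W_n) = \begin{cases} 2 & \text{if } n = 4,\\ 3 & \text{if } n>4 \text{ is even},\\ \infty & \text{otherwise.}\end{cases}$$
   Context: An exact $(k,d)$-coloring of a graph $G=(V,E)$ is a map $c: V\to\{1,\dots,k\}$ such that every vertex has exactly $d$ neighbors of its own color; $\chi_d^=(G)$ is the least $k$ for which one exists, and $\chi_d^=(G)=\infty$ if none exists. -}

module Defs where

open import Data.Nat using (ℕ; zero; suc; _+_; _≤_; _<_)
open import Data.Nat.Properties using (_≟_)
open import Data.Fin using (Fin; toℕ)
import Data.Fin.Properties as FinP
open import Data.Bool using (Bool; true; false; _∧_; _∨_; not)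
open import Data.List using (List; filter; length)
open import Data.List.Base using (allFin)
open import Data.Product using (Σ; ∃; _×_; _,_)
open import Relation.Nullary using (¬_; Dec; yes; no)
open import Relation.Nullary.Decidable using (⌊_⌋)
open import Relation.Binary.PropositionalEquality as Eq using (_≡_; refl)
open import Data.Empty using (⊥-elim)
open import Data.Bool.Properties using (∨-comm)

record Graph (n : ℕ) : Set where
  field
    adj    : Fin n → Fin n → Bool
    sym    : ∀ u v → adj u v ≡ adj v u
    irrefl : ∀ v → adj v v ≡ false
open Graph public

-- Wheel graph W_n on vertices 0..n-1: vertex 0 is the hub, adjacent to all
-- other vertices; vertices 1..n-1 form the cycle C_{n-1}, with i adjacent to
-- i+1 (for 1 ≤ i < n-1) and n-1 adjacent to 1.
wheelArc : ℕ → ℕ → ℕ → Bool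
wheelArc n i j = ⌊ i ≟ 0 ⌋ ∨ ⌊ suc i ≟ j ⌋ ∨ (⌊ i ≟ 1 ⌋ ∧ ⌊ suc j ≟ n ⌋)

wheelAdjℕ : ℕ → ℕ → ℕ → Bool
wheelAdjℕ n i j = not ⌊ i ≟ j ⌋ ∧ (wheelArc n i j ∨ wheelArc n j i)

private
  ≟-sym : ∀ i j → ⌊ i ≟ j ⌋ ≡ ⌊ j ≟ i ⌋
  ≟-sym i j with i ≟ j | j ≟ i
  ... | yes _ | yes _ = refl
  ... | no _  | no _  = refl
  ... | yes p | no q  = ⊥-elim (q (Eq.sym p))
  ... | no p  | yes q = ⊥-elim (p (Eq.sym q))

  ≟-refl : ∀ i → ⌊ i ≟ i ⌋ ≡ true
  ≟-refl i with i ≟ i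
  ... | yes _ = refl
  ... | no p  = ⊥-elim (p refl)

wheelAdjℕ-sym : ∀ n i j → wheelAdjℕ n i j ≡ wheelAdjℕ n j i
wheelAdjℕ-sym n i j rewrite ≟-sym i j | ∨-comm (wheelArc n i j) (wheelArc n j i) = refl

wheelAdjℕ-irrefl : ∀ n i → wheelAdjℕ n i i ≡ false
wheelAdjℕ-irrefl n i rewrite ≟-refl i = refl

wheel : (n : ℕ) → Graph n
wheel n = record
  { adj    = λ u v → wheelAdjℕ n (toℕ u) (toℕ v)
  ; sym    = λ u v → wheelAdjℕ-sym n (toℕ u) (toℕ v)
  ; irrefl = λ v → wheelAdjℕ-irrefl n (toℕ v)
  }

sameColorNeighbours : ∀ {n k} → Graph n → (Fin n → Fin k) → Fin n → ℕ
sameColorNeighbours {n} G c v =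
  length (filter (λ u → FinP._≟_ (c u) (c v)) (filter (λ u → adj G v u Data.Bool.≟ true) (allFin n)))
  where import Data.Bool

IsExactColoring : ∀ {n} → Graph n → (k d : ℕ) → (Fin n → Fin k) → Set
IsExactColoring G k d c = ∀ v → sameColorNeighbours G c v ≡ d

ExactColorable : ∀ {n} → Graph n → (k d : ℕ) → Set
ExactColorable {n} G k d = Σ (Fin n → Fin k) (IsExactColoring G k d)

ChiExactEq : ∀ {n} → Graph n → (d k : ℕ) → Set
ChiExactEq G d k = ExactColorable G k d × (∀ j → j < k → ¬ ExactColorable G j d)

-- χ_d^=(G) = ∞ : no exact (k,d)-coloring for any k.
ChiExactInfinite : ∀ {n} → Graph n → (d : ℕ) → Set
ChiExactInfinite G d = ∀ k → ¬ ExactColorable G k d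

-- If every vertex has exactly one neighbour of its own color, the same-colored
-- edges form a perfect matching, so by the handshake lemma n is even; for odd n
-- there is no exact (k,1)-coloring at all.  For even n, pair the hub 0 with the rim
-- vertex 1 (color 0) and cut the rim 2, 3, …, n-1 into consecutive pairs
-- {2i, 2i+1} colored alternately 1 and 2; the wrap edge joins n-1 to vertex 1,
-- which has the hub's color.  Fewer colors fail: one color gives the hub at least
-- two same-colored neighbours, and with two colors (n ≥ 6) the hub's unique
-- same-colored neighbour leaves three consecutive rim vertices of the other
-- color, whose middle vertex then has two same-colored neighbours.

module Submission where

open import Defs hiding (sym)
open import Data.Nat using (ℕ; zero; suc; _+_; _*_; _≤_; _<_; z≤n; s≤s)
open import Data.Nat.Properties using (+-0-commutativeMonoid; +-assoc; +-identityʳ; *-comm; suc-injective; 1+n≢n; _≟_)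
open import Data.Nat.Divisibility using (_∣_; _∣?_; divides; ∣-refl; ∣1⇒≡1; ∣m∣n⇒∣m+n; ∣m+n∣m⇒∣n)
open import Data.Fin using (Fin; zero; suc; toℕ; fromℕ; fromℕ<; #_)
import Data.Fin.Properties as Fin
open import Data.Bool using (Bool; true; false; T; _∧_; if_then_else_)
import Data.Bool as Bool
open import Data.Bool.Properties using (T-∧)
open import Data.List using (filter; length; tabulate)
open import Data.Product using (_×_; _,_)
open import Data.Empty using (⊥; ⊥-elim)
open import Data.Sum using (_⊎_; inj₁; inj₂)
open import Function using (_∘_; case_of_; mk⇔; Equivalence)
open Equivalence using (to; from)
open import Relation.Nullary using (¬_; Dec; yes; no; contradiction)
open import Relation.Nullary.Decidable using (⌊_⌋; from-no; does; toWitness; fromWitness; isYes≗does; does-⇔)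
open import Level using (0ℓ)
open import Relation.Unary using (Pred; Decidable)
open import Relation.Binary.PropositionalEquality using (_≡_; _≢_; refl; sym; trans; cong; cong₂; subst; module ≡-Reasoning)
open import Algebra.Properties.CommutativeMonoid.Sum +-0-commutativeMonoid using (sum; sum-cong-≗; ∑-distrib-+)

count : ∀ {n} → (Fin n → Bool) → ℕ
count p = sum (λ i → if p i then 1 else 0)

length-filter-filter-tabulate : ∀ {A : Set} {P Q : Pred A 0ℓ} (P? : Decidable P) (Q? : Decidable Q) {n} (f : Fin n → A) →
  length (filter Q? (filter P? (tabulate f))) ≡ count (λ i → ⌊ P? (f i) ⌋ ∧ ⌊ Q? (f i) ⌋)
length-filter-filter-tabulate P? Q? {zero} f = refl
length-filter-filter-tabulate P? Q? {suc n} f with P? (f zero)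
... | no _ = length-filter-filter-tabulate P? Q? (f ∘ suc)
... | yes _ with Q? (f zero)
...   | yes _ = cong suc (length-filter-filter-tabulate P? Q? (f ∘ suc))
...   | no _  = length-filter-filter-tabulate P? Q? (f ∘ suc)

count-none : ∀ {n} (p : Fin n → Bool) → (∀ i → ¬ T (p i)) → count p ≡ 0
count-none {zero} p none = refl
count-none {suc n} p none with p zero in eq
... | true  = ⊥-elim (none zero (subst T (sym eq) _))
... | false = count-none (p ∘ suc) (none ∘ suc)

count≡0⇒none : ∀ {n} (p : Fin n → Bool) → count p ≡ 0 → ∀ i → ¬ T (p i)
count≡0⇒none {suc n} p c≡0 i pi with p zero in eq | i
... | true  | _     = case c≡0 of λ ()
... | false | zero  = subst T eq pi
... | false | suc i = count≡0⇒none (p ∘ suc) c≡0 i pi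

count≡1⇒unique : ∀ {n} (p : Fin n → Bool) → count p ≡ 1 → ∀ {i j} → T (p i) → T (p j) → i ≡ j
count≡1⇒unique {suc n} p c≡1 {i} {j} pi pj with p zero in eq | i | j
... | true  | zero  | zero  = refl
... | true  | zero  | suc j = ⊥-elim (count≡0⇒none (p ∘ suc) (suc-injective c≡1) j pj)
... | true  | suc i | _     = ⊥-elim (count≡0⇒none (p ∘ suc) (suc-injective c≡1) i pi)
... | false | zero  | _     = ⊥-elim (subst T eq pi)
... | false | suc i | zero  = ⊥-elim (subst T eq pj)
... | false | suc i | suc j = cong suc (count≡1⇒unique (p ∘ suc) c≡1 pi pj)

unique⇒count≡1 : ∀ {n} (p : Fin n → Bool) {w} → T (p w) → (∀ i → T (p i) → i ≡ w) → count p ≡ 1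
unique⇒count≡1 {suc n} p {w} pw unique with p zero in eq | w
... | true  | zero  = cong suc (count-none (p ∘ suc) (λ i pi → case unique (suc i) pi of λ ()))
... | true  | suc w = case unique zero (subst T (sym eq) _) of λ ()
... | false | zero  = ⊥-elim (subst T eq pw)
... | false | suc w = unique⇒count≡1 (p ∘ suc) pw (λ i pi → Fin.suc-injective (unique (suc i) pi))

handshake : ∀ {n} (R : Fin n → Fin n → Bool) → (∀ u v → R u v ≡ R v u) → (∀ v → R v v ≡ false) →
  2 ∣ sum (λ v → count (R v))
handshake {zero} R symmetric irreflexive = divides 0 refl
handshake {suc n} R symmetric irreflexive = subst (2 ∣_) (sym total≡) (∣m∣n⇒∣m+n (divides deg₀ double) rest)
  where
  deg₀ : ℕ
  deg₀ = count (λ v → R (suc v) zero)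

  rest : 2 ∣ sum (λ v → count (R (suc v) ∘ suc))
  rest = handshake (λ u v → R (suc u) (suc v)) (λ u v → symmetric (suc u) (suc v)) (irreflexive ∘ suc)

  double : deg₀ + deg₀ ≡ deg₀ * 2
  double = trans (cong (deg₀ +_) (sym (+-identityʳ deg₀))) (*-comm 2 deg₀)

  row₀ : count (R zero) ≡ deg₀
  row₀ rewrite irreflexive zero = sum-cong-≗ (λ v → cong (λ b → if b then 1 else 0) (symmetric zero (suc v)))

  total≡ : sum (λ v → count (R v)) ≡ (deg₀ + deg₀) + sum (λ v → count (R (suc v) ∘ suc))
  total≡ = begin
    count (R zero) + sum (λ v → count (R (suc v)))          ≡⟨ cong₂ _+_ row₀ (∑-distrib-+ column₀ (λ v → count (R (suc v) ∘ suc))) ⟩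
    deg₀ + (deg₀ + sum (λ v → count (R (suc v) ∘ suc)))     ≡⟨ sym (+-assoc deg₀ deg₀ _) ⟩
    (deg₀ + deg₀) + sum (λ v → count (R (suc v) ∘ suc))     ∎
    where
    open ≡-Reasoning
    column₀ : Fin n → ℕ
    column₀ v = if R (suc v) zero then 1 else 0

sum-ones : ∀ n → sum {n} (λ _ → 1) ≡ n
sum-ones zero    = refl
sum-ones (suc n) = cong suc (sum-ones n)

⌊≟⌋-sym : ∀ {k} (x y : Fin k) → ⌊ x Fin.≟ y ⌋ ≡ ⌊ y Fin.≟ x ⌋
⌊≟⌋-sym x y = begin
  ⌊ x Fin.≟ y ⌋   ≡⟨ isYes≗does (x Fin.≟ y) ⟩
  does (x Fin.≟ y) ≡⟨ does-⇔ (mk⇔ sym sym) (x Fin.≟ y) (y Fin.≟ x) ⟩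
  does (y Fin.≟ x) ≡⟨ isYes≗does (y Fin.≟ x) ⟨
  ⌊ y Fin.≟ x ⌋   ∎
  where open ≡-Reasoning

module _ {n k} (G : Graph n) (c : Fin n → Fin k) where

  sameColorAdj : Fin n → Fin n → Bool
  sameColorAdj v u = adj G v u ∧ ⌊ c u Fin.≟ c v ⌋

  SameColorNeighbour : Fin n → Fin n → Set
  SameColorNeighbour v u = T (adj G v u) × c u ≡ c v

  sameColorNeighbours≡count : ∀ v → sameColorNeighbours G c v ≡ count (sameColorAdj v)
  sameColorNeighbours≡count v =
    trans (length-filter-filter-tabulate (λ u → adj G v u Bool.≟ true) (λ u → c u Fin.≟ c v) (λ u → u))
          (sum-cong-≗ (λ u → cong (λ b → if b ∧ ⌊ c u Fin.≟ c v ⌋ then 1 else 0) (⌊≟true⌋ (adj G v u))))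
    where
    ⌊≟true⌋ : ∀ b → ⌊ b Bool.≟ true ⌋ ≡ b
    ⌊≟true⌋ true  = refl
    ⌊≟true⌋ false = refl

  sameColorAdj⇒ : ∀ {v u} → T (sameColorAdj v u) → SameColorNeighbour v u
  sameColorAdj⇒ t = let a , e = T-∧ .to t in a , toWitness e

  ⇒sameColorAdj : ∀ {v u} → SameColorNeighbour v u → T (sameColorAdj v u)
  ⇒sameColorAdj (a , e) = T-∧ .from (a , fromWitness e)

  exact₁⇒even : IsExactColoring G k 1 c → 2 ∣ n
  exact₁⇒even exact = subst (2 ∣_) vertices≡ (handshake sameColorAdj symmetric irreflexive)
    where
    symmetric : ∀ u v → sameColorAdj u v ≡ sameColorAdj v u
    symmetric u v = cong₂ _∧_ (Graph.sym G u v) (⌊≟⌋-sym (c v) (c u))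
    irreflexive : ∀ v → sameColorAdj v v ≡ false
    irreflexive v = cong (_∧ ⌊ c v Fin.≟ c v ⌋) (irrefl G v)
    vertices≡ : sum (λ v → count (sameColorAdj v)) ≡ n
    vertices≡ = begin
      sum (λ v → count (sameColorAdj v))       ≡⟨ sum-cong-≗ (λ v → trans (sym (sameColorNeighbours≡count v)) (exact v)) ⟩
      sum {n} (λ _ → 1)                         ≡⟨ sum-ones n ⟩
      n                                         ∎
      where open ≡-Reasoning

  exact₁⇒partner-unique : IsExactColoring G k 1 c → ∀ {v a b} →
    SameColorNeighbour v a → SameColorNeighbour v b → a ≡ b
  exact₁⇒partner-unique exact {v} sa sb =
    count≡1⇒unique (sameColorAdj v) (trans (sym (sameColorNeighbours≡count v)) (exact v))
                   (⇒sameColorAdj sa) (⇒sameColorAdj sb)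

  partner⇒exact₁ : (partner : Fin n → Fin n) → (∀ v → SameColorNeighbour v (partner v)) →
    (∀ {v u} → SameColorNeighbour v u → u ≡ partner v) → IsExactColoring G k 1 c
  partner⇒exact₁ partner is-partner only-partner v =
    trans (sameColorNeighbours≡count v)
          (unique⇒count≡1 (sameColorAdj v) (⇒sameColorAdj (is-partner v)) (λ u t → only-partner (sameColorAdj⇒ t)))

-- Splitting on the equality tests inside wheelAdjℕ lets the Boolean formula evaluate.
wheelAdj-suc : ∀ n i → T (wheelAdjℕ n i (suc i))
wheelAdj-suc n i with i ≟ suc i | i ≟ 0 | suc i ≟ suc i
... | yes i≡1+i | _     | _          = ⊥-elim (1+n≢n (sym i≡1+i))
... | no _      | _     | no 1+i≢1+i = ⊥-elim (1+i≢1+i refl)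
... | no _      | yes _ | yes _      = _
... | no _      | no _  | yes _      = _

wheelAdj-pred : ∀ n i → T (wheelAdjℕ n (suc i) i)
wheelAdj-pred n i = subst T (wheelAdjℕ-sym n i (suc i)) (wheelAdj-suc n i)

wheelAdj-wrap : ∀ j → T (wheelAdjℕ (3 + j) 1 (2 + j))
wheelAdj-wrap j with 2 ≟ 2 + j | 3 + j ≟ 3 + j
... | _     | no ≢refl = ⊥-elim (≢refl refl)
... | yes _ | yes _    = _
... | no _  | yes _    = _

wheelAdj-cycle⇒ : ∀ n i j → T (wheelAdjℕ n (2 + i) (2 + j)) → suc i ≡ j ⊎ suc j ≡ i
wheelAdj-cycle⇒ n i j adjacent with 3 + i ≟ 2 + j | 3 + j ≟ 2 + i | 2 + i ≟ 2 + j
... | yes 3+i≡2+j | _           | _     = inj₁ (suc-injective (suc-injective 3+i≡2+j))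
... | no _        | yes 3+j≡2+i | _     = inj₂ (suc-injective (suc-injective 3+j≡2+i))
... | no _        | no _        | yes _ = ⊥-elim adjacent
... | no _        | no _        | no _  = ⊥-elim adjacent

mate : ℕ → ℕ
mate 0 = 1
mate 1 = 0
mate (suc (suc i)) = suc (suc (mate i))

mate-involutive : ∀ i → mate (mate i) ≡ i
mate-involutive 0 = refl
mate-involutive 1 = refl
mate-involutive (suc (suc i)) = cong (2 +_) (mate-involutive i)

mate-consecutive : ∀ i → mate i ≡ suc i ⊎ suc (mate i) ≡ i
mate-consecutive 0 = inj₁ refl
mate-consecutive 1 = inj₂ refl
mate-consecutive (suc (suc i)) with mate-consecutive i
... | inj₁ e = inj₁ (cong (2 +_) e)
... | inj₂ e = inj₂ (cong (2 +_) e)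

mate-< : ∀ {n} i → 2 ∣ n → i < n → mate i < n
mate-< {1}                0             2∣1 _                = contradiction (∣1⇒≡1 2∣1) (λ ())
mate-< {1}                (suc _)       _   (s≤s ())
mate-< {suc (suc n)}      0             _   _                = s≤s (s≤s z≤n)
mate-< {suc (suc n)}      1             _   _                = s≤s z≤n
mate-< {suc (suc n)}      (suc (suc i)) 2∣n (s≤s (s≤s i<n)) =
  s≤s (s≤s (mate-< i (∣m+n∣m⇒∣n 2∣n ∣-refl) i<n))

stripeColor : ℕ → Fin 3
stripeColor 0 = suc zero
stripeColor 1 = suc zero
stripeColor 2 = suc (suc zero)
stripeColor 3 = suc (suc zero)
stripeColor (suc (suc (suc (suc i)))) = stripeColor i

wheelColor : ℕ → Fin 3
wheelColor 0 = zero
wheelColor 1 = zero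
wheelColor (suc (suc i)) = stripeColor i

stripeColor≢0 : ∀ i → stripeColor i ≢ zero
stripeColor≢0 0 ()
stripeColor≢0 1 ()
stripeColor≢0 2 ()
stripeColor≢0 3 ()
stripeColor≢0 (suc (suc (suc (suc i)))) = stripeColor≢0 i

stripeColor-mate : ∀ i → stripeColor (mate i) ≡ stripeColor i
stripeColor-mate 0 = refl
stripeColor-mate 1 = refl
stripeColor-mate 2 = refl
stripeColor-mate 3 = refl
stripeColor-mate (suc (suc (suc (suc i)))) = stripeColor-mate i

stripeColor-suc : ∀ i → stripeColor (suc i) ≡ stripeColor i → mate i ≡ suc i
stripeColor-suc 0 _ = refl
stripeColor-suc 2 _ = refl
stripeColor-suc (suc (suc (suc (suc i)))) same = cong (4 +_) (stripeColor-suc i same)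

wheelColor-mate : ∀ i → wheelColor (mate i) ≡ wheelColor i
wheelColor-mate 0 = refl
wheelColor-mate 1 = refl
wheelColor-mate (suc (suc i)) = stripeColor-mate i

wheelColor-only-mate : ∀ n v u → T (wheelAdjℕ n v u) → wheelColor u ≡ wheelColor v → u ≡ mate v
wheelColor-only-mate n 0 1 _ _ = refl
wheelColor-only-mate n 1 0 _ _ = refl
wheelColor-only-mate n 0 (suc (suc j)) _ same = ⊥-elim (stripeColor≢0 j same)
wheelColor-only-mate n 1 (suc (suc j)) _ same = ⊥-elim (stripeColor≢0 j same)
wheelColor-only-mate n (suc (suc i)) 0 _ same = ⊥-elim (stripeColor≢0 i (sym same))
wheelColor-only-mate n (suc (suc i)) 1 _ same = ⊥-elim (stripeColor≢0 i (sym same))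
wheelColor-only-mate n (suc (suc i)) (suc (suc j)) adjacent same with wheelAdj-cycle⇒ n i j adjacent
... | inj₁ refl = cong (2 +_) (sym (stripeColor-suc i same))
... | inj₂ refl = cong (2 +_) (trans (sym (mate-involutive j)) (cong mate (stripeColor-suc j (sym same))))

wheelColoring : ∀ {n} → Fin n → Fin 3
wheelColoring = wheelColor ∘ toℕ

wheelColoring-exact₁ : ∀ {n} → 2 ∣ n → IsExactColoring (wheel n) 3 1 wheelColoring
wheelColoring-exact₁ {n} even = partner⇒exact₁ (wheel n) wheelColoring partner is-partner only-partner
  where
  partner : Fin n → Fin n
  partner v = fromℕ< (mate-< (toℕ v) even (Fin.toℕ<n v))

  toℕ-partner : ∀ v → toℕ (partner v) ≡ mate (toℕ v)
  toℕ-partner v = Fin.toℕ-fromℕ< _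

  is-partner : ∀ v → SameColorNeighbour (wheel n) wheelColoring v (partner v)
  is-partner v rewrite toℕ-partner v = adjacent (mate-consecutive (toℕ v)) , wheelColor-mate (toℕ v)
    where
    adjacent : ∀ {i} → mate i ≡ suc i ⊎ suc (mate i) ≡ i → T (wheelAdjℕ n i (mate i))
    adjacent {i} (inj₁ e) = subst (T ∘ wheelAdjℕ n i) (sym e) (wheelAdj-suc n i)
    adjacent {i} (inj₂ e) = subst (λ j → T (wheelAdjℕ n j (mate i))) e (wheelAdj-pred n (mate i))

  only-partner : ∀ {v u} → SameColorNeighbour (wheel n) wheelColoring v u → u ≡ partner v
  only-partner {v} {u} (adjacent , same) =
    Fin.toℕ-injective (trans (wheelColor-only-mate n (toℕ v) (toℕ u) adjacent same) (sym (toℕ-partner v)))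

no-exact-0-coloring : ∀ {n d} (G : Graph (suc n)) → ¬ ExactColorable G 0 d
no-exact-0-coloring G (c , _) with c zero
... | ()

wheel-no-exact₁-1-coloring : ∀ m → ¬ ExactColorable (wheel (3 + m)) 1 1
wheel-no-exact₁-1-coloring m (c , exact) =
  contradiction (exact₁⇒partner-unique (wheel (3 + m)) c exact {zero} {# 1} {# 2} (_ , all-equal _ _) (_ , all-equal _ _)) λ ()
  where
  all-equal : (x y : Fin 1) → x ≡ y
  all-equal zero zero = refl

Fin2-≢⇒≡ : (x y h : Fin 2) → x ≢ h → y ≢ h → x ≡ y
Fin2-≢⇒≡ zero          zero          _             _   _   = refl
Fin2-≢⇒≡ (suc zero)    (suc zero)    _             _   _   = refl
Fin2-≢⇒≡ zero          (suc zero)    zero          x≢h _   = ⊥-elim (x≢h refl)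
Fin2-≢⇒≡ zero          (suc zero)    (suc zero)    _   y≢h = ⊥-elim (y≢h refl)
Fin2-≢⇒≡ (suc zero)    zero          zero          _   y≢h = ⊥-elim (y≢h refl)
Fin2-≢⇒≡ (suc zero)    zero          (suc zero)    x≢h _   = ⊥-elim (x≢h refl)

wheel-no-exact₁-2-coloring : ∀ m → ¬ ExactColorable (wheel (6 + m)) 2 1
wheel-no-exact₁-2-coloring m (c , exact) = hubMate (c (# 1) Fin.≟ c hub) (c (# 2) Fin.≟ c hub) (c (# 3) Fin.≟ c hub)
  where
  G : Graph (6 + m)
  G = wheel (6 + m)
  hub last : Fin (6 + m)
  hub  = zero
  last = fromℕ (5 + m)

  wrap : T (adj G (# 1) last)
  wrap = subst (T ∘ wheelAdjℕ (6 + m) 1) (sym (Fin.toℕ-fromℕ (5 + m))) (wheelAdj-wrap (3 + m))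

  unique : ∀ {v a b} → SameColorNeighbour G c v a → SameColorNeighbour G c v b → a ≡ b
  unique = exact₁⇒partner-unique G c exact

  off : ∀ {a b} → c (suc a) ≡ c hub → suc a ≢ suc b → c (suc b) ≢ c hub
  off ha a≢b hb = a≢b (unique (_ , ha) (_ , hb))

  path : ∀ {x y z} → T (adj G y x) → T (adj G y z) → x ≢ z → c x ≢ c hub → c y ≢ c hub → c z ≢ c hub → ⊥
  path yx yz x≢z ¬hx ¬hy ¬hz = x≢z (unique (yx , Fin2-≢⇒≡ _ _ _ ¬hx ¬hy) (yz , Fin2-≢⇒≡ _ _ _ ¬hz ¬hy))

  hubMate : Dec (c (# 1) ≡ c hub) → Dec (c (# 2) ≡ c hub) → Dec (c (# 3) ≡ c hub) → ⊥
  hubMate (yes h₁) _        _        = path {# 2} {# 3} {# 4} _ _ (λ ()) (off h₁ (λ ())) (off h₁ (λ ())) (off h₁ (λ ()))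
  hubMate (no ¬h₁) (yes h₂) _        = path {# 3} {# 4} {# 5} _ _ (λ ()) (off h₂ (λ ())) (off h₂ (λ ())) (off h₂ (λ ()))
  hubMate (no ¬h₁) (no ¬h₂) (yes h₃) = path {# 2} {# 1} {last} _ wrap (λ ()) ¬h₂ ¬h₁ (off h₃ (λ ()))
  hubMate (no ¬h₁) (no ¬h₂) (no ¬h₃) = path {# 1} {# 2} {# 3} _ _ (λ ()) ¬h₁ ¬h₂ ¬h₃

W₄-coloring : Fin 4 → Fin 2
W₄-coloring zero          = zero
W₄-coloring (suc zero)    = zero
W₄-coloring (suc (suc _)) = suc zero

W₄-coloring-exact₁ : IsExactColoring (wheel 4) 2 1 W₄-coloring
W₄-coloring-exact₁ zero                   = refl
W₄-coloring-exact₁ (suc zero)             = refl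
W₄-coloring-exact₁ (suc (suc zero))       = refl
W₄-coloring-exact₁ (suc (suc (suc zero))) = refl

χ₁-W₄ : ChiExactEq (wheel 4) 1 2
χ₁-W₄ = (W₄-coloring , W₄-coloring-exact₁) , fewer
  where
  fewer : ∀ j → j < 2 → ¬ ExactColorable (wheel 4) j 1
  fewer 0 _ = no-exact-0-coloring (wheel 4)
  fewer 1 _ = wheel-no-exact₁-1-coloring 1
  fewer (suc (suc _)) (s≤s (s≤s ()))

χ₁-W-even : ∀ {n} → 4 < n → 2 ∣ n → ChiExactEq (wheel n) 1 3
χ₁-W-even (s≤s (s≤s (s≤s (s≤s (s≤s (z≤n {zero})))))) 2∣5 = contradiction 2∣5 (from-no (2 ∣? 5))
χ₁-W-even (s≤s (s≤s (s≤s (s≤s (s≤s (z≤n {suc m})))))) even = (wheelColoring , wheelColoring-exact₁ even) , fewer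
  where
  fewer : ∀ j → j < 3 → ¬ ExactColorable (wheel (6 + m)) j 1
  fewer 0 _ = no-exact-0-coloring (wheel (6 + m))
  fewer 1 _ = wheel-no-exact₁-1-coloring (3 + m)
  fewer 2 _ = wheel-no-exact₁-2-coloring m
  fewer (suc (suc (suc _))) (s≤s (s≤s (s≤s ())))

χ₁-W-odd : ∀ {n} → ¬ (2 ∣ n) → ChiExactInfinite (wheel n) 1
χ₁-W-odd {n} odd k (c , exact) = odd (exact₁⇒even (wheel n) c exact)

-- 4 ≤ n is not needed: the first two cases force it and the third holds for every odd n.
mainTheorem8 : (n : ℕ) → 4 ≤ n →
    (n ≡ 4 → ChiExactEq (wheel n) 1 2)
    × (4 < n → 2 ∣ n → ChiExactEq (wheel n) 1 3)
    × (¬ (2 ∣ n) → ChiExactInfinite (wheel n) 1)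
mainTheorem8 n _ = (λ { refl → χ₁-W₄ }) , χ₁-W-even , χ₁-W-odd
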